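{- Let $(U,\mathcal{F},\kappa)$ be an instance of \textsc{Hitting Set} with $|U|=n$, $0\le\kappa\le n$, and let $G$ be the graph with vertices $m_F$ ($F\in\mathcal{F}$), $v_u$ ($u\in U$; $Q_1=\{v_u:u\in U\}$), a set $Q_2$ of $n-\kappa$ further vertices, and $m_1,m_2$, where $Q_1$ and $Q_2$ are cliques, $m_1,m_2$ are adjacent to each other and to all of $Q_1\cup Q_2$, $N_G(m_F)=\{v_u:u\in F\}$, and there are no other edges. Let $\ell=n+2$. Then $(G,\ell)$ is a yes-instance of \textsc{Dominator Coloring} if and only if there exists a dominator coloring $\chi$ of $G$ using exactly $n+2$ colors such that $\chi(m_1)=\chi(m_F)$ for all $F\in\mathcal{F}$.
   Context: A dominator coloring of $G$ is a proper coloring in which every vertex $v$ dominates some color class (the class is contained in $N_G[v]=N_G(v)\cup\{v\}$). \textsc{Dominator Coloring}: given $(G,\ell)$, decide whether $G$ has a dominator coloring with at most $\ell$ colors. -}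

module Defs where

open import Data.Nat using (ℕ; _+_; _∸_)
open import Data.Fin using (Fin)
open import Data.Fin.Subset using (Subset; _∈_)
open import Data.Empty using (⊥)
open import Data.Unit using (⊤)
open import Data.Product using (Σ; ∃; _×_)
open import Data.Sum using (_⊎_)
open import Relation.Nullary using (¬_)
open import Relation.Binary.PropositionalEquality using (_≡_; _≢_)
open import Function.Definitions using (Surjective)

-- Generic notions: a (simple) graph is a vertex type V with an adjacency
-- relation Adj; a coloring with at most c colors is a map V → Fin c.

Proper : {V : Set} (Adj : V → V → Set) {c : ℕ} (χ : V → Fin c) → Set
Proper {V} Adj χ = ∀ (u w : V) → Adj u w → χ u ≢ χ w

DominatesClass : {V : Set} (Adj : V → V → Set) {c : ℕ} (χ : V → Fin c)
                 (v : V) (i : Fin c) → Set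
DominatesClass {V} Adj χ v i =
  (Σ V λ w → χ w ≡ i) × (∀ (w : V) → χ w ≡ i → (w ≡ v ⊎ Adj v w))

IsDominatorColoring : {V : Set} (Adj : V → V → Set) {c : ℕ} (χ : V → Fin c) → Set
IsDominatorColoring {V} Adj {c} χ =
  Proper Adj χ × (∀ (v : V) → Σ (Fin c) λ i → DominatesClass Adj χ v i)

DominatorColorable : {V : Set} (Adj : V → V → Set) (ℓ : ℕ) → Set
DominatorColorable {V} Adj ℓ = Σ (V → Fin ℓ) λ χ → IsDominatorColoring Adj χ

-- The reduction graph.  Hitting Set instance: U = Fin n, the family
-- 𝓕 = (F i)_{i : Fin k} of subsets of U, and κ.

data Vtx (n k κ : ℕ) : Set where
  mF : Fin k → Vtx n k κ
  vU : Fin n → Vtx n k κ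
  q  : Fin (n ∸ κ) → Vtx n k κ
  m₁ : Vtx n k κ
  m₂ : Vtx n k κ

Adj : (n k κ : ℕ) (F : Fin k → Subset n) → Vtx n k κ → Vtx n k κ → Set
Adj n k κ F (mF i) (vU u) = u ∈ F i
Adj n k κ F (vU u) (mF i) = u ∈ F i
Adj n k κ F (vU u) (vU u') = u ≢ u'
Adj n k κ F (q a) (q b) = a ≢ b
Adj n k κ F m₁ m₂ = ⊤
Adj n k κ F m₂ m₁ = ⊤
Adj n k κ F m₁ (vU _) = ⊤
Adj n k κ F m₁ (q _) = ⊤
Adj n k κ F m₂ (vU _) = ⊤
Adj n k κ F m₂ (q _) = ⊤
Adj n k κ F (vU _) m₁ = ⊤
Adj n k κ F (q _) m₁ = ⊤
Adj n k κ F (vU _) m₂ = ⊤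
Adj n k κ F (q _) m₂ = ⊤
Adj n k κ F _ _ = ⊥

-- Q₁ ∪ {m₁, m₂} is a clique on n + 2 vertices, so a proper colouring with
-- n + 2 colours uses every colour on it.  Recolour every m_F with the colour
-- of m₁: as N(m_F) ⊆ Q₁ ⊆ N(m₁) the colouring stays proper, and every colour
-- still occurs on the clique.  Now m₂ is alone in its class, which all
-- vertices except the m_F dominate.  A class dominated by m_F misses m₁
-- (m₁ ∉ N[m_F]), so recolouring only removes vertices from it and m_F keeps
-- dominating it.
module Submission where

open import Defs
open import Data.Nat using (ℕ; _+_; _≤_)
import Data.Nat as ℕ
open import Data.Nat.Properties using (n<1+n)
open import Data.Fin using (Fin; zero; suc; splitAt; join; punchOut)
open import Data.Fin.Properties
  using (_≟_; any?; punchOut-injective; <⇒notInjective; join-splitAt)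
open import Data.Fin.Subset using (Subset)
open import Data.Product using (Σ; _×_; _,_; proj₁; proj₂)
open import Data.Sum using (_⊎_; inj₁; inj₂; [_,_])
open import Data.Unit using (tt)
open import Data.Empty using (⊥-elim)
open import Relation.Nullary using (yes; no; contradiction)
open import Relation.Binary.PropositionalEquality
  using (_≡_; _≢_; refl; sym; trans; cong; subst)
open import Function using (_∘_)
open import Function.Definitions using (Injective; Surjective; StrictlySurjective)
open import Function.Consequences.Propositional using (strictlySurjective⇒surjective)
open import Function.Bundles using (_⇔_; mk⇔)

injective⇒strictlySurjective : ∀ {N} {g : Fin N → Fin N} →
  Injective _≡_ _≡_ g → StrictlySurjective _≡_ g
injective⇒strictlySurjective {ℕ.suc N} {g} g-inj c with any? (λ x → g x ≟ c)
... | yes hit = hit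
... | no miss = ⊥-elim (<⇒notInjective (n<1+n N) skip-injective)
  where
  c≢g : ∀ x → c ≢ g x
  c≢g x c≡gx = miss (x , sym c≡gx)

  skip : Fin (ℕ.suc N) → Fin N
  skip x = punchOut (c≢g x)

  skip-injective : Injective _≡_ _≡_ skip
  skip-injective {x} {y} = g-inj ∘ punchOut-injective (c≢g x) (c≢g y)

proper⇒injective-on-clique :
  ∀ {V : Set} {_~_ : V → V → Set} {c m} {χ : V → Fin c} (e : Fin m → V) →
  Proper _~_ χ → (∀ {i j} → i ≢ j → e i ~ e j) → Injective _≡_ _≡_ (χ ∘ e)
proper⇒injective-on-clique e proper clique {i} {j} same with i ≟ j
... | yes i≡j = i≡j
... | no i≢j = contradiction same (proper (e i) (e j) (clique i≢j))

proper-∘-homomorphism :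
  ∀ {V W : Set} {_~_ : V → V → Set} {_≈_ : W → W → Set} {c}
    {χ : W → Fin c} {f : V → W} →
  Proper _≈_ χ → (∀ {u w} → u ~ w → f u ≈ f w) → Proper _~_ (χ ∘ f)
proper-∘-homomorphism proper hom u w u~w = proper _ _ (hom u~w)

module Reduction (n k κ : ℕ) (F : Fin k → Subset n) where

  V : Set
  V = Vtx n k κ

  _~_ : V → V → Set
  _~_ = Adj n k κ F

  core′ : Fin n ⊎ Fin 2 → V
  core′ (inj₁ u) = vU u
  core′ (inj₂ zero) = m₁
  core′ (inj₂ (suc zero)) = m₂

  core : Fin (n + 2) → V
  core = core′ ∘ splitAt n

  core′-clique : ∀ {x y} → x ≢ y → core′ x ~ core′ y
  core′-clique {inj₁ u} {inj₁ u'} x≢y = x≢y ∘ cong inj₁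
  core′-clique {inj₁ _} {inj₂ zero} _ = tt
  core′-clique {inj₁ _} {inj₂ (suc zero)} _ = tt
  core′-clique {inj₂ zero} {inj₁ _} _ = tt
  core′-clique {inj₂ zero} {inj₂ zero} x≢y = x≢y refl
  core′-clique {inj₂ zero} {inj₂ (suc zero)} _ = tt
  core′-clique {inj₂ (suc zero)} {inj₁ _} _ = tt
  core′-clique {inj₂ (suc zero)} {inj₂ zero} _ = tt
  core′-clique {inj₂ (suc zero)} {inj₂ (suc zero)} x≢y = x≢y refl

  core-clique : ∀ {i j} → i ≢ j → core i ~ core j
  core-clique {i} {j} i≢j = core′-clique λ split≡ →
    i≢j (trans (sym (join-splitAt n 2 i))
               (trans (cong (join n 2) split≡) (join-splitAt n 2 j)))

  retract : V → V
  retract (mF _) = m₁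
  retract w = w

  retract-core′ : ∀ x → retract (core′ x) ≡ core′ x
  retract-core′ (inj₁ _) = refl
  retract-core′ (inj₂ zero) = refl
  retract-core′ (inj₂ (suc zero)) = refl

  retract-core : ∀ i → retract (core i) ≡ core i
  retract-core i = retract-core′ (splitAt n i)

  retract-homomorphism : ∀ {u w} → u ~ w → retract u ~ retract w
  retract-homomorphism {mF _} {vU _} _ = tt
  retract-homomorphism {mF _} {mF _} ()
  retract-homomorphism {mF _} {q _} ()
  retract-homomorphism {mF _} {m₁} ()
  retract-homomorphism {mF _} {m₂} ()
  retract-homomorphism {vU _} {mF _} _ = tt
  retract-homomorphism {vU _} {vU _} u~w = u~w
  retract-homomorphism {vU _} {q _} ()
  retract-homomorphism {vU _} {m₁} _ = tt
  retract-homomorphism {vU _} {m₂} _ = tt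
  retract-homomorphism {q _} {mF _} ()
  retract-homomorphism {q _} {vU _} ()
  retract-homomorphism {q _} {q _} u~w = u~w
  retract-homomorphism {q _} {m₁} _ = tt
  retract-homomorphism {q _} {m₂} _ = tt
  retract-homomorphism {m₁} {mF _} ()
  retract-homomorphism {m₁} {vU _} _ = tt
  retract-homomorphism {m₁} {q _} _ = tt
  retract-homomorphism {m₁} {m₁} ()
  retract-homomorphism {m₁} {m₂} _ = tt
  retract-homomorphism {m₂} {mF _} ()
  retract-homomorphism {m₂} {vU _} _ = tt
  retract-homomorphism {m₂} {q _} _ = tt
  retract-homomorphism {m₂} {m₁} _ = tt
  retract-homomorphism {m₂} {m₂} ()

  module Collapse (χ : V → Fin (n + 2)) (dominator : IsDominatorColoring _~_ χ) where

    proper : Proper _~_ χ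
    proper = proj₁ dominator

    every-colour-on-core : StrictlySurjective _≡_ (χ ∘ core)
    every-colour-on-core =
      injective⇒strictlySurjective (proper⇒injective-on-clique core proper core-clique)

    collapse : V → Fin (n + 2)
    collapse = χ ∘ retract

    collapse-strictlySurjective : StrictlySurjective _≡_ collapse
    collapse-strictlySurjective c =
      let i , χcore≡c = every-colour-on-core c
      in core i , trans (cong χ (retract-core i)) χcore≡c

    collapse-proper : Proper _~_ collapse
    collapse-proper = proper-∘-homomorphism proper retract-homomorphism

    collapse-class-m₂ : ∀ w → collapse w ≡ χ m₂ → w ≡ m₂
    collapse-class-m₂ (mF _) same = contradiction same (proper m₁ m₂ tt)
    collapse-class-m₂ (vU u) same = contradiction same (proper (vU u) m₂ tt)
    collapse-class-m₂ (q a) same = contradiction same (proper (q a) m₂ tt)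
    collapse-class-m₂ m₁ same = contradiction same (proper m₁ m₂ tt)
    collapse-class-m₂ m₂ _ = refl

    collapse-class⊆class : ∀ {j} w → χ m₁ ≢ j → collapse w ≡ j → χ w ≡ j
    collapse-class⊆class (mF _) m₁∉j m₁∈j = contradiction m₁∈j m₁∉j
    collapse-class⊆class (vU _) _ w∈j = w∈j
    collapse-class⊆class (q _) _ w∈j = w∈j
    collapse-class⊆class m₁ _ w∈j = w∈j
    collapse-class⊆class m₂ _ w∈j = w∈j

    dominates-class-m₂ : ∀ v → m₂ ≡ v ⊎ v ~ m₂ → DominatesClass _~_ collapse v (χ m₂)
    dominates-class-m₂ v m₂∈N[v] = (m₂ , refl) , λ w w∈m₂ →
      subst (λ x → x ≡ v ⊎ v ~ x) (sym (collapse-class-m₂ w w∈m₂)) m₂∈N[v]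

    mF-keeps-dominating : ∀ {i j} → DominatesClass _~_ χ (mF i) j →
      DominatesClass _~_ collapse (mF i) j
    mF-keeps-dominating {j = j} (_ , j⊆N[mF]) =
      collapse-strictlySurjective j ,
      λ w w∈j → j⊆N[mF] w (collapse-class⊆class w m₁∉j w∈j)
      where
      m₁∉j : χ m₁ ≢ j
      m₁∉j m₁∈j = [ (λ ()) , (λ ()) ] (j⊆N[mF] m₁ m₁∈j)

    collapse-dominates : ∀ v → Σ (Fin (n + 2)) (DominatesClass _~_ collapse v)
    collapse-dominates (mF i) =
      let j , dom = proj₂ dominator (mF i) in j , mF-keeps-dominating dom
    collapse-dominates (vU u) = χ m₂ , dominates-class-m₂ (vU u) (inj₂ tt)
    collapse-dominates (q a) = χ m₂ , dominates-class-m₂ (q a) (inj₂ tt)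
    collapse-dominates m₁ = χ m₂ , dominates-class-m₂ m₁ (inj₂ tt)
    collapse-dominates m₂ = χ m₂ , dominates-class-m₂ m₂ (inj₁ refl)

    collapse-dominator : IsDominatorColoring _~_ collapse
    collapse-dominator = collapse-proper , collapse-dominates

lemma6 : (n k κ : ℕ) → κ ≤ n → (F : Fin k → Subset n) →
    DominatorColorable (Adj n k κ F) (n + 2)
    ⇔ (Σ (Vtx n k κ → Fin (n + 2)) λ χ →
         IsDominatorColoring (Adj n k κ F) χ
         × Surjective _≡_ _≡_ χ
         × (∀ (i : Fin k) → χ m₁ ≡ χ (mF i)))
lemma6 n k κ _ F = mk⇔ collapsed forget
  where
  open Reduction n k κ F

  MergedColouring : Set
  MergedColouring = Σ (V → Fin (n + 2)) λ χ →
    IsDominatorColoring _~_ χ × Surjective _≡_ _≡_ χ × (∀ i → χ m₁ ≡ χ (mF i))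

  collapsed : DominatorColorable _~_ (n + 2) → MergedColouring
  collapsed (χ , dominator) =
    collapse , collapse-dominator ,
    strictlySurjective⇒surjective collapse-strictlySurjective , λ _ → refl
    where open Collapse χ dominator

  forget : MergedColouring → DominatorColorable _~_ (n + 2)
  forget (χ , dominator , _) = χ , dominator
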